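{- There is an absolute constant $c>0$ such that for all $n$ and $k\ge 2$ the following holds: for any (randomized or deterministic) non-adaptive strategy for black-peg Mastermind with $n$ positions and $k$ colors, the expected number of queries needed to determine a secret code $z$ sampled uniformly at random from $[k]^n$ is at least $c\,\frac{n\log k}{\max\{\log(n/k),1\}}$, i.e., it is $\Omega\!\left(\frac{n\log k}{\max\{\log(n/k),1\}}\right)$.
   Context: In black-peg Mastermind with $n$ positions and $k$ colors, a guess $x\in[k]^n$ is answered by $\mathrm{eq}(z,x)=|\{i: z_i=x_i\}|$, where $z\in[k]^n$ is the secret code. A deterministic non-adaptive strategy is a fixed ordering $x^1,x^2,\dots,x^{k^n}$ of all elements of $[k]^n$; a randomized non-adaptive strategy is a probability distribution over such orderings. For a secret code $z$, the number of queries needed to determine $z$ is the smallest index $j$ such that $x^1,\dots,x^j$ together with $\mathrm{eq}(z,x^1),\dots,\mathrm{eq}(z,x^j)$ uniquely determine $z$ (i.e., $z$ is the only code in $[k]^n$ consistent with these answers). $\log$ is the binary logarithm.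
   Formalization: Randomized non-adaptive strategies are distributions over orderings with rational probabilities, given by natural-number weights on finitely many orderings. -}

module Defs where

open import Data.Nat using (ℕ; zero; suc; _+_; _*_; _^_; _<_)
open import Data.Fin using (Fin; toℕ)
open import Data.Fin.Properties using (_≟_)
open import Data.Vec using (Vec; []; _∷_)
open import Data.List using (List; []; _∷_; [_]; map; concatMap; allFin)
open import Data.Nat.ListAction using (sum)
open import Data.Product using (_×_; _,_)
open import Function.Bundles using (_⤖_; Bijection)
open import Relation.Nullary using (¬_; yes; no)
open import Relation.Binary.PropositionalEquality using (_≡_)

Code : ℕ → ℕ → Set
Code n k = Vec (Fin k) n

eqCount : ∀ {n k} → Code n k → Code n k → ℕ
eqCount []       []       = 0
eqCount (a ∷ as) (b ∷ bs) with a ≟ b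
... | yes _ = suc (eqCount as bs)
... | no  _ = eqCount as bs

allCodes : ∀ n k → List (Code n k)
allCodes zero    k = [ [] ]
allCodes (suc n) k = concatMap (λ c → map (c ∷_) (allCodes n k)) (allFin k)

-- A deterministic non-adaptive strategy: an ordering x^1,...,x^{k^n} of [k]^n,
-- i.e. a bijection Fin (k^n) ⤖ [k]^n (index i corresponds to query x^{i+1}).
Strategy : ℕ → ℕ → Set
Strategy n k = Fin (k ^ n) ⤖ Code n k

query : ∀ {n k} → Strategy n k → Fin (k ^ n) → Code n k
query σ = Bijection.to σ

Determined : ∀ {n k} → Strategy n k → Code n k → ℕ → Set
Determined {n} {k} σ z j =
  ∀ (y : Code n k) →
    (∀ (i : Fin (k ^ n)) → toℕ i < j → eqCount y (query σ i) ≡ eqCount z (query σ i)) →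
    y ≡ z

QueriesNeeded : ∀ {n k} → Strategy n k → Code n k → ℕ → Set
QueriesNeeded σ z j = Determined σ z j × (∀ j′ → j′ < j → ¬ Determined σ z j′)

record CountedStrategy (n k : ℕ) : Set where
  field
    order     : Strategy n k
    needed    : Code n k → ℕ
    isNeeded  : ∀ z → QueriesNeeded order z (needed z)

totalQueries : ∀ {n k} → CountedStrategy n k → ℕ
totalQueries {n} {k} s = sum (map (CountedStrategy.needed s) (allCodes n k))

-- A randomized strategy: finitely many deterministic strategies with natural weights
-- (probability of the i-th one = w_i / Σ w).
Randomized : ℕ → ℕ → Set
Randomized n k = List (ℕ × CountedStrategy n k)

totalWeight : ∀ {n k} → Randomized n k → ℕ
totalWeight [] = 0
totalWeight ((w , _) ∷ r) = w + totalWeight r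

-- A = Σ_i w_i · Σ_z needed_i(z).  Expected number of queries for uniform z is
-- E = A / B with B = (Σ w) · k^n.
weightedTotal : ∀ {n k} → Randomized n k → ℕ
weightedTotal [] = 0
weightedTotal ((w , s) ∷ r) = w * totalQueries s + weightedTotal r

{-# OPTIONS --safe #-}
module Submission where

open import Data.Nat
  using (ℕ; zero; suc; _+_; _*_; _∸_; _^_; _≤_; _<_; _≤?_; _<?_; z≤n; s≤s; s≤s⁻¹; NonZero; >-nonZero⁻¹; _⊔_)
open import Data.Nat.Properties
open import Data.Nat.DivMod using (_/_; _%_; m/n*n≤m; /-monoˡ-≤; m*n/n≡m; m≡m%n+[m/n]*n; m%n<n)
open import Data.Nat.ListAction using (sum)
open import Data.Nat.ListAction.Properties using (sum-++)
open import Data.Nat.Tactic.RingSolver using (solve-∀)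
open import Data.Fin using (Fin; toℕ; fromℕ<) renaming (zero to fzero; suc to fsuc)
import Data.Fin.Properties as Fin
open import Data.Vec using ([]; _∷_)
import Data.Vec.Properties as Vec
open import Data.List
  using (List; []; _∷_; map; filter; length; concatMap; cartesianProductWith; allFin; downFrom; _++_)
open import Data.List.Properties using (map-++; map-∘; length-map; length-++; length-tabulate; length-downFrom)
open import Data.List.Membership.Propositional using (_∈_; _∉_)
open import Data.List.Membership.Propositional.Properties using (∈-filter⁻; ∈-allFin; ∈-downFrom⁺)
open import Data.List.Relation.Unary.All as All using (All; []; _∷_)
open import Data.List.Relation.Unary.Any using (here; there)
open import Data.List.Relation.Unary.Unique.Propositional using (Unique)
open import Data.List.Relation.Unary.AllPairs using ([]; _∷_)
import Data.List.Relation.Unary.Unique.Propositional.Properties as Unique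
open import Data.Product using (Σ; _×_; _,_; proj₁; proj₂)
open import Data.Empty using (⊥-elim)
open import Data.Sum using (inj₁; inj₂)
open import Function using (_∘_)
open import Relation.Nullary using (Dec; yes; no; ¬_)
open import Level using (0ℓ)
open import Relation.Unary using (Pred; Decidable)
open import Relation.Unary.Properties using (∁?)
open import Relation.Binary using (DecidableEquality)
open import Relation.Binary.PropositionalEquality
open import Defs

-- Fix a deterministic strategy and a budget J, let Q be its first J queries and S the codes it
-- determines within J queries, so that Q separates S. Group the answers 0, …, n into blocks of size
-- B ≈ n/k and let level z = Σ_{x ∈ Q} ⌊eq(z,x)/B⌋. Since a query has only n + 1 answers, a Kraft-type
-- inequality gives Σ_{z ∈ S} 2^(−level z) ≤ (2B)^J, while the average level over all codes is at most J
-- because the average answer is n/k ≤ B. Markov's inequality then gives |S| ≤ 2(8B)^J + k^n/2. For the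
-- largest J with 8(8B)^J ≤ k^n, at least a quarter of all codes need more than J queries, so the total
-- number of queries is at least (J+1)·k^n/4, where (J+1)·log(64B) > n log k and 64B·k^8 ≤ max(n,2k)^8.
-- A randomized strategy is a weighted sum of deterministic ones.

indicator : ∀ {p} {P : Set p} → Dec P → ℕ
indicator (yes _) = 1
indicator (no _)  = 0

private variable
  A C : Set

sum-map-++ : ∀ (f : A → ℕ) xs ys → sum (map f (xs ++ ys)) ≡ sum (map f xs) + sum (map f ys)
sum-map-++ f xs ys = trans (cong sum (map-++ f xs ys)) (sum-++ (map f xs) (map f ys))

sum-map-+ : ∀ (f g : A → ℕ) xs →
            sum (map (λ x → f x + g x) xs) ≡ sum (map f xs) + sum (map g xs)
sum-map-+ f g []       = refl
sum-map-+ f g (x ∷ xs) rewrite sum-map-+ f g xs = interchange (f x) (g x) _ _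
  where
  interchange : ∀ a b c d → (a + b) + (c + d) ≡ (a + c) + (b + d)
  interchange = solve-∀

sum-map-*ˡ : ∀ c (f : A → ℕ) xs → sum (map (λ x → c * f x) xs) ≡ c * sum (map f xs)
sum-map-*ˡ c f []       = sym (*-zeroʳ c)
sum-map-*ˡ c f (x ∷ xs) rewrite sum-map-*ˡ c f xs = sym (*-distribˡ-+ c (f x) _)

sum-map-const : ∀ c (xs : List A) → sum (map (λ _ → c) xs) ≡ length xs * c
sum-map-const c []       = refl
sum-map-const c (x ∷ xs) = cong (c +_) (sum-map-const c xs)

sum-map-mono : ∀ (f g : A → ℕ) xs → (∀ {x} → x ∈ xs → f x ≤ g x) →
               sum (map f xs) ≤ sum (map g xs)
sum-map-mono f g []       f≤g = z≤n
sum-map-mono f g (x ∷ xs) f≤g = +-mono-≤ (f≤g (here refl)) (sum-map-mono f g xs (f≤g ∘ there))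

sum-map-cong : ∀ (f g : A → ℕ) xs → (∀ {x} → x ∈ xs → f x ≡ g x) →
               sum (map f xs) ≡ sum (map g xs)
sum-map-cong f g []       f≡g = refl
sum-map-cong f g (x ∷ xs) f≡g = cong₂ _+_ (f≡g (here refl)) (sum-map-cong f g xs (f≡g ∘ there))

sum-map-concatMap : ∀ (f : C → ℕ) (g : A → List C) xs →
                    sum (map f (concatMap g xs)) ≡ sum (map (λ x → sum (map f (g x))) xs)
sum-map-concatMap f g []       = refl
sum-map-concatMap f g (x ∷ xs) =
  trans (sum-map-++ f (g x) (concatMap g xs)) (cong (sum (map f (g x)) +_) (sum-map-concatMap f g xs))

sum-map-map : ∀ (f : C → ℕ) (g : A → C) xs → sum (map f (map g xs)) ≡ sum (map (f ∘ g) xs)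
sum-map-map f g xs = cong sum (sym (map-∘ {g = f} {f = g} xs))

sum-map-swap : ∀ (f : A → C → ℕ) xs ys →
               sum (map (λ x → sum (map (f x) ys)) xs) ≡ sum (map (λ y → sum (map (λ x → f x y) xs)) ys)
sum-map-swap f []       ys = sym (trans (sum-map-const 0 ys) (*-zeroʳ (length ys)))
sum-map-swap f (x ∷ xs) ys rewrite sum-map-swap f xs ys = sym (sum-map-+ (f x) _ ys)

module _ {A : Set} {P : Pred A 0ℓ} (P? : Decidable P) where

  sum-map-filter≤ : ∀ (f : A → ℕ) xs → sum (map f (filter P? xs)) ≤ sum (map f xs)
  sum-map-filter≤ f []       = z≤n
  sum-map-filter≤ f (x ∷ xs) with P? x
  ... | yes _ = +-monoʳ-≤ (f x) (sum-map-filter≤ f xs)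
  ... | no  _ = ≤-trans (sum-map-filter≤ f xs) (m≤n+m _ (f x))

  sum-map-filter-∷ : ∀ (f : A → ℕ) x xs →
    sum (map f (filter P? (x ∷ xs))) ≡ indicator (P? x) * f x + sum (map f (filter P? xs))
  sum-map-filter-∷ f x xs with P? x
  ... | yes _ = cong (_+ sum (map f (filter P? xs))) (sym (+-identityʳ (f x)))
  ... | no  _ = refl

  length-filter-∁ : ∀ xs → length (filter P? xs) + length (filter (∁? P?) xs) ≡ length xs
  length-filter-∁ []       = refl
  length-filter-∁ (x ∷ xs) with P? x
  ... | yes _ = cong suc (length-filter-∁ xs)
  ... | no  _ = trans (+-suc _ _) (cong suc (length-filter-∁ xs))

module _ {A : Set} (_≟_ : DecidableEquality A) where

  sum-map-indicator-∉ : ∀ b c {xs} → b ∉ xs → sum (map (λ x → indicator (x ≟ b) * c) xs) ≡ 0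
  sum-map-indicator-∉ b c {[]}     b∉ = refl
  sum-map-indicator-∉ b c {x ∷ xs} b∉ with x ≟ b
  ... | yes refl = ⊥-elim (b∉ (here refl))
  ... | no  _    = sum-map-indicator-∉ b c (b∉ ∘ there)

  sum-map-indicator : ∀ b c {xs} → Unique xs → b ∈ xs →
                      sum (map (λ x → indicator (x ≟ b) * c) xs) ≡ c
  sum-map-indicator b c u@(_ ∷ _) (here refl) with b ≟ b
  ... | yes _  = trans (cong (1 * c +_) (sum-map-indicator-∉ b c (Unique.Unique[x∷xs]⇒x∉xs u)))
                       (trans (+-identityʳ (1 * c)) (*-identityˡ c))
  ... | no b≢b = ⊥-elim (b≢b refl)
  sum-map-indicator b c {x ∷ _} (x≢ ∷ u) (there b∈) with x ≟ b
  ... | yes refl = ⊥-elim (All.lookup x≢ b∈ refl)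
  ... | no  _    = sum-map-indicator b c u b∈

sum-map-partition : ∀ {A : Set} (f : A → ℕ) L → (∀ x → f x < L) → ∀ (F : A → ℕ) xs →
  sum (map F xs) ≡ sum (map (λ b → sum (map F (filter (λ x → b ≟ f x) xs))) (downFrom L))
sum-map-partition f L f<L F [] = sym (trans (sum-map-const 0 (downFrom L)) (*-zeroʳ (length (downFrom L))))
sum-map-partition f L f<L F (x ∷ xs) = sym (begin
    sum (map (λ b → sum (map F (filter (λ y → b ≟ f y) (x ∷ xs)))) (downFrom L))
      ≡⟨ sum-map-cong _ _ (downFrom L) (λ {b} _ → sum-map-filter-∷ (λ y → b ≟ f y) F x xs) ⟩
    sum (map (λ b → indicator (b ≟ f x) * F x + sum (map F (filter (λ y → b ≟ f y) xs))) (downFrom L))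
      ≡⟨ sum-map-+ (λ b → indicator (b ≟ f x) * F x) _ (downFrom L) ⟩
    sum (map (λ b → indicator (b ≟ f x) * F x) (downFrom L))
      + sum (map (λ b → sum (map F (filter (λ y → b ≟ f y) xs))) (downFrom L))
      ≡⟨ cong₂ _+_ (sum-map-indicator _≟_ (f x) (F x) (Unique.downFrom⁺ L) (∈-downFrom⁺ (f<L x)))
                   (sym (sum-map-partition f L f<L F xs)) ⟩
    F x + sum (map F xs) ∎)
  where open ≡-Reasoning

sum-map-downFrom-+ : ∀ (f : ℕ → ℕ) p q →
  sum (map f (downFrom (p + q))) ≡ sum (map (λ i → f (q + i)) (downFrom p)) + sum (map f (downFrom q))
sum-map-downFrom-+ f zero    q = refl
sum-map-downFrom-+ f (suc p) q rewrite sum-map-downFrom-+ f p q | +-comm p q =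
  sym (+-assoc (f (q + p)) _ _)

sum-map-downFrom-mono : ∀ (f : ℕ → ℕ) {L L′} → L ≤ L′ →
  sum (map f (downFrom L)) ≤ sum (map f (downFrom L′))
sum-map-downFrom-mono f {L} {L′} L≤L′ = begin
  sum (map f (downFrom L))                  ≤⟨ m≤n+m _ _ ⟩
  _ + sum (map f (downFrom L))              ≡⟨ sym (sum-map-downFrom-+ f (L′ ∸ L) L) ⟩
  sum (map f (downFrom (L′ ∸ L + L)))       ≡⟨ cong (sum ∘ map f ∘ downFrom) (m∸n+n≡m L≤L′) ⟩
  sum (map f (downFrom L′))                 ∎
  where open ≤-Reasoning

geometric-sum : ∀ E r → r ≤ suc E →
  sum (map (λ q → 2 ^ (E ∸ q)) (downFrom r)) + 2 ^ (suc E ∸ r) ≡ 2 ^ suc E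
geometric-sum E zero    _ = refl
geometric-sum E (suc r) r<2+E = begin
    (2 ^ (E ∸ r) + S) + 2 ^ (E ∸ r)  ≡⟨ shuffle (2 ^ (E ∸ r)) S ⟩
    S + 2 * 2 ^ (E ∸ r)              ≡⟨ cong (λ e → S + 2 ^ e) (sym (+-∸-assoc 1 (s≤s⁻¹ r<2+E))) ⟩
    S + 2 ^ (suc E ∸ r)              ≡⟨ geometric-sum E r (m≤n⇒m≤1+n (s≤s⁻¹ r<2+E)) ⟩
    2 ^ suc E                        ∎
  where
  open ≡-Reasoning
  S : ℕ
  S = sum (map (λ q → 2 ^ (E ∸ q)) (downFrom r))
  shuffle : ∀ a s → (a + s) + a ≡ s + 2 * a
  shuffle = solve-∀

^-distribʳ-* : ∀ a b e → (a * b) ^ e ≡ a ^ e * b ^ e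
^-distribʳ-* a b zero    = refl
^-distribʳ-* a b (suc e) rewrite ^-distribʳ-* a b e = shuffle a b (a ^ e) (b ^ e)
  where
  shuffle : ∀ a b x y → a * b * (x * y) ≡ a * x * (b * y)
  shuffle = solve-∀

crossing : ∀ {P : ℕ → Set} → (∀ j → Dec (P j)) → P 0 → ∀ b → ¬ P b → Σ ℕ λ j → P j × ¬ P (suc j)
crossing P? p₀ zero    ¬p = ⊥-elim (¬p p₀)
crossing P? p₀ (suc b) ¬p with P? b
... | yes p  = b , p , ¬p
... | no ¬p′ = crossing P? p₀ b ¬p′

n<2^n : ∀ n → n < 2 ^ n
n<2^n zero    = s≤s z≤n
n<2^n (suc n) = subst (suc (suc n) ≤_) (cong (2 ^ n +_) (sym (+-identityʳ (2 ^ n))))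
                      (+-mono-≤ (m^n>0 2 n) (n<2^n n))

N≤4*complement : ∀ {N a b Y} → N ≡ a + b → 2 * a ≤ 2 * Y + N → 4 * Y ≤ N → N ≤ 4 * b
N≤4*complement {N} {a} {b} {Y} N≡a+b 2a≤2Y+N 4Y≤N = +-cancelˡ-≤ (3 * N) N (4 * b) (begin
  3 * N + N        ≡⟨ collect N ⟩
  4 * N            ≡⟨ cong (4 *_) N≡a+b ⟩
  4 * (a + b)      ≡⟨ *-distribˡ-+ 4 a b ⟩
  4 * a + 4 * b    ≤⟨ +-monoˡ-≤ (4 * b) 4a≤3N ⟩
  3 * N + 4 * b    ∎)
  where
  open ≤-Reasoning
  collect : ∀ N → 3 * N + N ≡ 4 * N
  collect = solve-∀
  4a≤3N : 4 * a ≤ 3 * N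
  4a≤3N = begin
    4 * a            ≡⟨ *-assoc 2 2 a ⟩
    2 * (2 * a)      ≤⟨ *-monoʳ-≤ 2 2a≤2Y+N ⟩
    2 * (2 * Y + N)  ≡⟨ expand Y N ⟩
    4 * Y + 2 * N    ≤⟨ +-monoˡ-≤ (2 * N) 4Y≤N ⟩
    N + 2 * N        ≡⟨ collect′ N ⟩
    3 * N            ∎
    where
    expand : ∀ Y N → 2 * (2 * Y + N) ≡ 4 * Y + 2 * N
    expand = solve-∀
    collect′ : ∀ N → N + 2 * N ≡ 3 * N
    collect′ = solve-∀

eqCount-∷ : ∀ {n k} (a b : Fin k) (as bs : Code n k) →
            eqCount (a ∷ as) (b ∷ bs) ≡ indicator (a Fin.≟ b) + eqCount as bs
eqCount-∷ a b as bs with a Fin.≟ b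
... | yes _ = refl
... | no  _ = refl

eqCount≤n : ∀ {n k} (z x : Code n k) → eqCount z x ≤ n
eqCount≤n []       []       = z≤n
eqCount≤n (a ∷ as) (b ∷ bs) with a Fin.≟ b
... | yes _ = s≤s (eqCount≤n as bs)
... | no  _ = m≤n⇒m≤1+n (eqCount≤n as bs)

concatMap-map≡cartesianProductWith : ∀ {A B C : Set} (f : A → B → C) xs ys →
  concatMap (λ x → map (f x) ys) xs ≡ cartesianProductWith f xs ys
concatMap-map≡cartesianProductWith f []       ys = refl
concatMap-map≡cartesianProductWith f (x ∷ xs) ys =
  cong (map (f x) ys ++_) (concatMap-map≡cartesianProductWith f xs ys)

length-cartesianProductWith : ∀ {A B C : Set} (f : A → B → C) xs ys →
  length (cartesianProductWith f xs ys) ≡ length xs * length ys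
length-cartesianProductWith f []       ys = refl
length-cartesianProductWith f (x ∷ xs) ys = begin
  length (map (f x) ys ++ cartesianProductWith f xs ys)
    ≡⟨ length-++ (map (f x) ys) ⟩
  length (map (f x) ys) + length (cartesianProductWith f xs ys)
    ≡⟨ cong₂ _+_ (length-map (f x) ys) (length-cartesianProductWith f xs ys) ⟩
  length ys + length xs * length ys ∎
  where open ≡-Reasoning

allCodes-suc : ∀ n k → allCodes (suc n) k ≡ cartesianProductWith _∷_ (allFin k) (allCodes n k)
allCodes-suc n k = concatMap-map≡cartesianProductWith _∷_ (allFin k) (allCodes n k)

length-allFin : ∀ k → length (allFin k) ≡ k
length-allFin k = length-tabulate {n = k} (λ i → i)

length-allCodes : ∀ n k → length (allCodes n k) ≡ k ^ n
length-allCodes zero    k = refl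
length-allCodes (suc n) k = begin
  length (allCodes (suc n) k)                                   ≡⟨ cong length (allCodes-suc n k) ⟩
  length (cartesianProductWith _∷_ (allFin k) (allCodes n k))
    ≡⟨ length-cartesianProductWith _∷_ (allFin k) (allCodes n k) ⟩
  length (allFin k) * length (allCodes n k)
    ≡⟨ cong₂ _*_ (length-allFin k) (length-allCodes n k) ⟩
  k * k ^ n                                                     ∎
  where open ≡-Reasoning

sum-map-allCodes-const : ∀ n k c → sum (map (λ _ → c) (allCodes n k)) ≡ k ^ n * c
sum-map-allCodes-const n k c = trans (sum-map-const c (allCodes n k)) (cong (_* c) (length-allCodes n k))

allCodes-unique : ∀ n k → Unique (allCodes n k)
allCodes-unique zero    k = [] ∷ []
allCodes-unique (suc n) k = subst Unique (sym (allCodes-suc n k))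
  (Unique.cartesianProductWith⁺ _∷_ Vec.∷-injective (Unique.allFin⁺ k) (allCodes-unique n k))

sum-map-allCodes-suc : ∀ n k (f : Code (suc n) k → ℕ) →
  sum (map f (allCodes (suc n) k)) ≡ sum (map (λ a → sum (map (λ z → f (a ∷ z)) (allCodes n k))) (allFin k))
sum-map-allCodes-suc n k f =
  trans (sum-map-concatMap f (λ a → map (a ∷_) (allCodes n k)) (allFin k))
        (sum-map-cong _ _ (allFin k) (λ {a} _ → sum-map-map f (a ∷_) (allCodes n k)))

sum-eqCount : ∀ n k (x : Code n k) → sum (map (λ z → eqCount z x) (allCodes n k)) * k ≡ n * k ^ n
sum-eqCount zero    k []       = refl
sum-eqCount (suc n) k (b ∷ x) = begin
    sum (map (λ z → eqCount z (b ∷ x)) (allCodes (suc n) k)) * k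
      ≡⟨ cong (_* k) (sum-map-allCodes-suc n k (λ z → eqCount z (b ∷ x))) ⟩
    sum (map (λ a → sum (map (λ z → eqCount (a ∷ z) (b ∷ x)) (allCodes n k))) (allFin k)) * k
      ≡⟨ cong (_* k) (sum-map-cong _ _ (allFin k) (λ {a} _ → first-position a)) ⟩
    sum (map (λ a → indicator (a Fin.≟ b) * k ^ n + S) (allFin k)) * k
      ≡⟨ cong (_* k) (sum-map-+ (λ a → indicator (a Fin.≟ b) * k ^ n) (λ _ → S) (allFin k)) ⟩
    (sum (map (λ a → indicator (a Fin.≟ b) * k ^ n) (allFin k)) + sum (map (λ _ → S) (allFin k))) * k
      ≡⟨ cong₂ (λ u v → (u + v) * k)
               (sum-map-indicator Fin._≟_ b (k ^ n) (Unique.allFin⁺ k) (∈-allFin b))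
               (trans (sum-map-const S (allFin k)) (cong (_* S) (length-allFin k))) ⟩
    (k ^ n + k * S) * k
      ≡⟨ distribute (k ^ n) k S ⟩
    k ^ n * k + k * (S * k)
      ≡⟨ cong (λ t → k ^ n * k + k * t) (sum-eqCount n k x) ⟩
    k ^ n * k + k * (n * k ^ n)
      ≡⟨ shuffle n k (k ^ n) ⟩
    suc n * (k * k ^ n) ∎
  where
  open ≡-Reasoning
  S : ℕ
  S = sum (map (λ z → eqCount z x) (allCodes n k))
  distribute : ∀ p k s → (p + k * s) * k ≡ p * k + k * (s * k)
  distribute = solve-∀
  shuffle : ∀ n k p → p * k + k * (n * p) ≡ suc n * (k * p)
  shuffle = solve-∀
  first-position : ∀ a →
    sum (map (λ z → eqCount (a ∷ z) (b ∷ x)) (allCodes n k)) ≡ indicator (a Fin.≟ b) * k ^ n + S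
  first-position a = begin
    sum (map (λ z → eqCount (a ∷ z) (b ∷ x)) (allCodes n k))
      ≡⟨ sum-map-cong _ _ (allCodes n k) (λ {z} _ → eqCount-∷ a b z x) ⟩
    sum (map (λ z → indicator (a Fin.≟ b) + eqCount z x) (allCodes n k))
      ≡⟨ sum-map-+ (λ _ → indicator (a Fin.≟ b)) (λ z → eqCount z x) (allCodes n k) ⟩
    sum (map (λ _ → indicator (a Fin.≟ b)) (allCodes n k)) + S
      ≡⟨ cong (_+ S) (sum-map-allCodes-const n k _) ⟩
    k ^ n * indicator (a Fin.≟ b) + S
      ≡⟨ cong (_+ S) (*-comm (k ^ n) _) ⟩
    indicator (a Fin.≟ b) * k ^ n + S ∎

all-equal⇒length≤1 : ∀ {A : Set} {xs : List A} → Unique xs → (∀ {y z} → y ∈ xs → z ∈ xs → y ≡ z) →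
                        length xs ≤ 1
all-equal⇒length≤1 {xs = []}         _              _   = z≤n
all-equal⇒length≤1 {xs = _ ∷ []}     _              _   = ≤-refl
all-equal⇒length≤1 {xs = _ ∷ _ ∷ _} ((x≢y ∷ _) ∷ _) all≡ =
  ⊥-elim (x≢y (all≡ (here refl) (there (here refl))))

Agree : ∀ {n k} → List (Code n k) → Code n k → Code n k → Set
Agree Q y z = All (λ x → eqCount y x ≡ eqCount z x) Q

Separates : ∀ {n k} → List (Code n k) → List (Code n k) → Set
Separates Q S = ∀ {y z} → y ∈ S → z ∈ S → Agree Q y z → y ≡ z

-- mass Q z = 2^(|Q|·q₀ − level Q z) (see mass*2^level) is a product of one weight per query, which
-- is what makes the Kraft inequality go through.
module Kraft (n k B : ℕ) {{_ : NonZero k}} {{_ : NonZero B}} where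

  q₀ : ℕ
  q₀ = n / B

  weight : ℕ → ℕ
  weight a = 2 ^ (q₀ ∸ a / B)

  K : ℕ
  K = sum (map weight (downFrom (suc n)))

  mass : List (Code n k) → Code n k → ℕ
  mass []      z = 1
  mass (x ∷ Q) z = weight (eqCount z x) * mass Q z

  level : List (Code n k) → Code n k → ℕ
  level Q z = sum (map (λ x → eqCount z x / B) Q)

  kraft : ∀ Q S → Unique S → Separates Q S → sum (map (mass Q) S) ≤ K ^ length Q
  kraft []      S u sep = begin
    sum (map (λ _ → 1) S)  ≡⟨ trans (sum-map-const 1 S) (*-identityʳ (length S)) ⟩
    length S               ≤⟨ all-equal⇒length≤1 u (λ y∈ z∈ → sep y∈ z∈ []) ⟩
    1                      ∎
    where open ≤-Reasoning
  kraft (x ∷ Q) S u sep = begin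
    sum (map (mass (x ∷ Q)) S)
      ≡⟨ sum-map-partition (λ z → eqCount z x) (suc n) (λ z → s≤s (eqCount≤n z x)) _ S ⟩
    sum (map (λ b → sum (map (mass (x ∷ Q)) (answering b))) (downFrom (suc n)))
      ≤⟨ sum-map-mono _ _ (downFrom (suc n)) (λ {b} _ → class-bound b) ⟩
    sum (map (λ b → K ^ length Q * weight b) (downFrom (suc n)))
      ≡⟨ sum-map-*ˡ (K ^ length Q) weight (downFrom (suc n)) ⟩
    K ^ length Q * K
      ≡⟨ *-comm (K ^ length Q) K ⟩
    K ^ length (x ∷ Q) ∎
    where
    open ≤-Reasoning
    answers : ∀ b z → Dec (b ≡ eqCount z x)
    answers b z = b ≟ eqCount z x
    answering : ℕ → List (Code n k)
    answering b = filter (answers b) S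
    class-bound : ∀ b → sum (map (mass (x ∷ Q)) (answering b)) ≤ K ^ length Q * weight b
    class-bound b = begin
      sum (map (mass (x ∷ Q)) (answering b))
        ≡⟨ sum-map-cong _ _ (answering b) (λ z∈ → cong (λ a → weight a * _) (sym (answer z∈))) ⟩
      sum (map (λ z → weight b * mass Q z) (answering b))
        ≡⟨ sum-map-*ˡ (weight b) (mass Q) (answering b) ⟩
      weight b * sum (map (mass Q) (answering b))
        ≤⟨ *-monoʳ-≤ (weight b) (kraft Q (answering b) (Unique.filter⁺ (answers b) u) sep′) ⟩
      weight b * K ^ length Q
        ≡⟨ *-comm (weight b) _ ⟩
      K ^ length Q * weight b ∎
      where
      answer : ∀ {z} → z ∈ answering b → b ≡ eqCount z x
      answer z∈ = proj₂ (∈-filter⁻ (answers b) {xs = S} z∈)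
      sep′ : Separates Q (answering b)
      sep′ y∈ z∈ agree with ∈-filter⁻ (answers b) {xs = S} y∈ | ∈-filter⁻ (answers b) {xs = S} z∈
      ... | y∈S , b≡y | z∈S , b≡z = sep y∈S z∈S (trans (sym b≡y) b≡z ∷ agree)

  weight-block : ∀ r i → weight (r * B + i) ≤ 2 ^ (q₀ ∸ r)
  weight-block r i = ^-monoʳ-≤ 2 (∸-monoʳ-≤ q₀ (begin
    r                ≡⟨ sym (m*n/n≡m r B) ⟩
    r * B / B        ≤⟨ /-monoˡ-≤ B (m≤m+n (r * B) i) ⟩
    (r * B + i) / B  ∎))
    where open ≤-Reasoning

  sum-weight-blocks : ∀ r →
    sum (map weight (downFrom (r * B))) ≤ B * sum (map (λ q → 2 ^ (q₀ ∸ q)) (downFrom r))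
  sum-weight-blocks zero    = z≤n
  sum-weight-blocks (suc r) = begin
    sum (map weight (downFrom (B + r * B)))
      ≡⟨ sum-map-downFrom-+ weight B (r * B) ⟩
    sum (map (λ i → weight (r * B + i)) (downFrom B)) + sum (map weight (downFrom (r * B)))
      ≤⟨ +-mono-≤ (sum-map-mono _ _ (downFrom B) (λ {i} _ → weight-block r i)) (sum-weight-blocks r) ⟩
    sum (map (λ _ → 2 ^ (q₀ ∸ r)) (downFrom B)) + B * G
      ≡⟨ cong (_+ B * G) (trans (sum-map-const _ (downFrom B)) (cong (_* 2 ^ (q₀ ∸ r)) (length-downFrom B))) ⟩
    B * 2 ^ (q₀ ∸ r) + B * G
      ≡⟨ sym (*-distribˡ-+ B _ G) ⟩
    B * (2 ^ (q₀ ∸ r) + G) ∎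
    where
    open ≤-Reasoning
    G : ℕ
    G = sum (map (λ q → 2 ^ (q₀ ∸ q)) (downFrom r))

  K≤B*2^[1+q₀] : K ≤ B * 2 ^ suc q₀
  K≤B*2^[1+q₀] = begin
    sum (map weight (downFrom (suc n)))                   ≤⟨ sum-map-downFrom-mono weight 1+n≤[1+q₀]*B ⟩
    sum (map weight (downFrom (suc q₀ * B)))              ≤⟨ sum-weight-blocks (suc q₀) ⟩
    B * sum (map (λ q → 2 ^ (q₀ ∸ q)) (downFrom (suc q₀))) ≤⟨ *-monoʳ-≤ B geometric ⟩
    B * 2 ^ suc q₀                                        ∎
    where
    open ≤-Reasoning
    1+n≤[1+q₀]*B : suc n ≤ suc q₀ * B
    1+n≤[1+q₀]*B = begin
      suc n                  ≡⟨ cong suc (m≡m%n+[m/n]*n n B) ⟩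
      suc (n % B + q₀ * B)   ≤⟨ +-monoˡ-≤ (q₀ * B) (m%n<n n B) ⟩
      B + q₀ * B             ∎
    geometric : sum (map (λ q → 2 ^ (q₀ ∸ q)) (downFrom (suc q₀))) ≤ 2 ^ suc q₀
    geometric = ≤-trans (m≤m+n _ _) (≤-reflexive (geometric-sum q₀ (suc q₀) ≤-refl))

  mass*2^level : ∀ Q z → mass Q z * 2 ^ level Q z ≡ 2 ^ (length Q * q₀)
  mass*2^level []      z = refl
  mass*2^level (x ∷ Q) z = begin
    (2 ^ (q₀ ∸ a) * mass Q z) * 2 ^ (a + level Q z)
      ≡⟨ cong ((2 ^ (q₀ ∸ a) * mass Q z) *_) (^-distribˡ-+-* 2 a (level Q z)) ⟩
    (2 ^ (q₀ ∸ a) * mass Q z) * (2 ^ a * 2 ^ level Q z)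
      ≡⟨ shuffle (2 ^ (q₀ ∸ a)) (mass Q z) (2 ^ a) (2 ^ level Q z) ⟩
    (2 ^ (q₀ ∸ a) * 2 ^ a) * (mass Q z * 2 ^ level Q z)
      ≡⟨ cong₂ _*_ (trans (sym (^-distribˡ-+-* 2 (q₀ ∸ a) a)) (cong (2 ^_) (m∸n+n≡m a≤q₀)))
                   (mass*2^level Q z) ⟩
    2 ^ q₀ * 2 ^ (length Q * q₀)
      ≡⟨ sym (^-distribˡ-+-* 2 q₀ _) ⟩
    2 ^ (q₀ + length Q * q₀) ∎
    where
    open ≡-Reasoning
    a : ℕ
    a = eqCount z x / B
    a≤q₀ : a ≤ q₀
    a≤q₀ = /-monoˡ-≤ B (eqCount≤n z x)
    shuffle : ∀ p q r s → (p * q) * (r * s) ≡ (p * r) * (q * s)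
    shuffle = solve-∀

  B*level≤ : ∀ Q z → B * level Q z ≤ sum (map (eqCount z) Q)
  B*level≤ []      z = ≤-reflexive (*-zeroʳ B)
  B*level≤ (x ∷ Q) z = begin
    B * (eqCount z x / B + level Q z)      ≡⟨ *-distribˡ-+ B _ _ ⟩
    B * (eqCount z x / B) + B * level Q z
      ≤⟨ +-mono-≤ (≤-trans (≤-reflexive (*-comm B _)) (m/n*n≤m (eqCount z x) B)) (B*level≤ Q z) ⟩
    eqCount z x + sum (map (eqCount z) Q)  ∎
    where open ≤-Reasoning

  threshold : ℕ → ℕ
  threshold t = 2 * (8 * B) ^ t

  threshold-unfold : ∀ t → 2 ^ suc (t + t) * (B ^ t * 2 ^ t) ≡ threshold t
  threshold-unfold zero    = refl
  threshold-unfold (suc t) = begin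
    2 ^ suc (suc t + suc t) * (B ^ suc t * 2 ^ suc t)
      ≡⟨ cong (λ e → 2 ^ suc (suc e) * (B ^ suc t * 2 ^ suc t)) (+-suc t t) ⟩
    2 * (2 * (2 * 2 ^ (t + t))) * (B * B ^ t * (2 * 2 ^ t))
      ≡⟨ shuffle (2 ^ (t + t)) B (B ^ t) (2 ^ t) ⟩
    8 * B * (2 ^ suc (t + t) * (B ^ t * 2 ^ t))
      ≡⟨ cong (8 * B *_) (threshold-unfold t) ⟩
    8 * B * (2 * (8 * B) ^ t)
      ≡⟨ *-comm-middle (8 * B) ((8 * B) ^ t) ⟩
    2 * (8 * B) ^ suc t ∎
    where
    open ≡-Reasoning
    shuffle : ∀ p b c q → 2 * (2 * (2 * p)) * (b * c * (2 * q)) ≡ 8 * b * (2 * p * (c * q))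
    shuffle = solve-∀
    *-comm-middle : ∀ a b → a * (2 * b) ≡ 2 * (a * b)
    *-comm-middle = solve-∀

  4*threshold≤[64B]^ : ∀ s → 4 * threshold (suc s) ≤ (64 * B) ^ suc s
  4*threshold≤[64B]^ s = begin
    4 * (2 * (8 * B) ^ suc s)     ≡⟨ sym (*-assoc 4 2 ((8 * B) ^ suc s)) ⟩
    8 * (8 * B) ^ suc s           ≤⟨ *-monoˡ-≤ ((8 * B) ^ suc s) (*-monoʳ-≤ 8 (m^n>0 8 s)) ⟩
    8 ^ suc s * (8 * B) ^ suc s   ≡⟨ sym (^-distribʳ-* 8 (8 * B) (suc s)) ⟩
    (8 * (8 * B)) ^ suc s         ≡⟨ cong (_^ suc s) (sym (*-assoc 8 8 B)) ⟩
    (64 * B) ^ suc s              ∎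
    where open ≤-Reasoning

  t<4*threshold : ∀ t → t < 4 * threshold t
  t<4*threshold t = begin-strict
    t                 <⟨ n<2^n t ⟩
    2 ^ t             ≤⟨ ^-monoˡ-≤ t (≤-trans (s≤s (s≤s z≤n)) (*-monoʳ-≤ 8 (>-nonZero⁻¹ B))) ⟩
    (8 * B) ^ t       ≤⟨ m≤n*m ((8 * B) ^ t) 8 ⟩
    8 * (8 * B) ^ t   ≡⟨ *-assoc 4 2 ((8 * B) ^ t) ⟩
    4 * threshold t   ∎
    where open ≤-Reasoning

  mass-sum-bound : ∀ Q S → Unique S → Separates Q S →
                   sum (map (mass Q) S) ≤ B ^ length Q * 2 ^ length Q * 2 ^ (length Q * q₀)
  mass-sum-bound Q S u sep = begin
    sum (map (mass Q) S)          ≤⟨ kraft Q S u sep ⟩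
    K ^ t                         ≤⟨ ^-monoˡ-≤ t K≤B*2^[1+q₀] ⟩
    (B * 2 ^ suc q₀) ^ t          ≡⟨ ^-distribʳ-* B (2 ^ suc q₀) t ⟩
    B ^ t * (2 ^ suc q₀) ^ t      ≡⟨ cong (B ^ t *_) (^-*-assoc 2 (suc q₀) t) ⟩
    B ^ t * 2 ^ (suc q₀ * t)      ≡⟨ cong (λ e → B ^ t * 2 ^ e) (expand q₀ t) ⟩
    B ^ t * 2 ^ (t + t * q₀)      ≡⟨ cong (B ^ t *_) (^-distribˡ-+-* 2 t (t * q₀)) ⟩
    B ^ t * (2 ^ t * 2 ^ (t * q₀)) ≡⟨ sym (*-assoc (B ^ t) (2 ^ t) _) ⟩
    B ^ t * 2 ^ t * 2 ^ (t * q₀)  ∎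
    where
    open ≤-Reasoning
    t : ℕ
    t = length Q
    expand : ∀ q t → suc q * t ≡ t + t * q
    expand = solve-∀

  level-sum-bound : n ≤ B * k → ∀ Q → sum (map (level Q) (allCodes n k)) ≤ length Q * k ^ n
  level-sum-bound n≤B*k Q = *-cancelˡ-≤ (B * k) {{m*n≢0 B k}} (begin
    B * k * sum (map (level Q) all)
      ≡⟨ shuffle B k _ ⟩
    B * sum (map (level Q) all) * k
      ≡⟨ cong (_* k) (sym (sum-map-*ˡ B (level Q) all)) ⟩
    sum (map (λ z → B * level Q z) all) * k
      ≤⟨ *-monoˡ-≤ k (sum-map-mono _ _ all (λ {z} _ → B*level≤ Q z)) ⟩
    sum (map (λ z → sum (map (eqCount z) Q)) all) * k
      ≡⟨ cong (_* k) (sum-map-swap eqCount all Q) ⟩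
    sum (map (λ x → sum (map (λ z → eqCount z x) all)) Q) * k
      ≡⟨ *-comm _ k ⟩
    k * sum (map (λ x → sum (map (λ z → eqCount z x) all)) Q)
      ≡⟨ sym (sum-map-*ˡ k _ Q) ⟩
    sum (map (λ x → k * sum (map (λ z → eqCount z x) all)) Q)
      ≡⟨ sum-map-cong _ _ Q (λ {x} _ → trans (*-comm k _) (sum-eqCount n k x)) ⟩
    sum (map (λ _ → n * k ^ n) Q)
      ≡⟨ sum-map-const (n * k ^ n) Q ⟩
    length Q * (n * k ^ n)
      ≤⟨ *-monoʳ-≤ (length Q) (*-monoˡ-≤ (k ^ n) n≤B*k) ⟩
    length Q * (B * k * k ^ n)
      ≡⟨ shuffle′ (length Q) (B * k) (k ^ n) ⟩
    B * k * (length Q * k ^ n) ∎)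
    where
    open ≤-Reasoning
    all : List (Code n k)
    all = allCodes n k
    shuffle : ∀ b k s → b * k * s ≡ b * s * k
    shuffle = solve-∀
    shuffle′ : ∀ t p N → t * (p * N) ≡ p * (t * N)
    shuffle′ = solve-∀

  -- Markov's inequality for level Q z at cut-off ℓ, multiplied through by 2^(|Q|·q₀).
  markov : ∀ ℓ Q z →
    2 ^ (length Q * q₀) * suc ℓ ≤ suc ℓ * 2 ^ ℓ * mass Q z + 2 ^ (length Q * q₀) * level Q z
  markov ℓ Q z with level Q z ≤? ℓ
  ... | yes level≤ℓ = ≤-trans (begin
    D * suc ℓ                       ≡⟨ *-comm D (suc ℓ) ⟩
    suc ℓ * D                       ≡⟨ cong (suc ℓ *_) (sym (mass*2^level Q z)) ⟩
    suc ℓ * (mass Q z * 2 ^ level Q z)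
      ≤⟨ *-monoʳ-≤ (suc ℓ) (*-monoʳ-≤ (mass Q z) (^-monoʳ-≤ 2 level≤ℓ)) ⟩
    suc ℓ * (mass Q z * 2 ^ ℓ)      ≡⟨ shuffle (suc ℓ) (mass Q z) (2 ^ ℓ) ⟩
    suc ℓ * 2 ^ ℓ * mass Q z        ∎) (m≤m+n _ _)
    where
    open ≤-Reasoning
    D : ℕ
    D = 2 ^ (length Q * q₀)
    shuffle : ∀ a m p → a * (m * p) ≡ a * p * m
    shuffle = solve-∀
  ... | no  level≰ℓ = ≤-trans (*-monoʳ-≤ (2 ^ (length Q * q₀)) (≰⇒> level≰ℓ)) (m≤n+m _ _)

  few-separated : ∀ {P : Pred (Code n k) 0ℓ} (P? : Decidable P) Q → n ≤ B * k →
                  Separates Q (filter P? (allCodes n k)) →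
                  2 * length (filter P? (allCodes n k)) ≤ 2 * threshold (length Q) + k ^ n
  few-separated P? Q n≤B*k sep = *-cancelˡ-≤ (suc t) (begin
    suc t * (2 * s)                   ≡⟨ regroup t s ⟩
    suc ℓ * s                         ≤⟨ *-cancelˡ-≤ D {{m^n≢0 2 (t * q₀)}} summed ⟩
    suc ℓ * threshold t + t * N       ≤⟨ +-monoʳ-≤ (suc ℓ * threshold t) (*-monoˡ-≤ N (n≤1+n t)) ⟩
    suc ℓ * threshold t + suc t * N   ≡⟨ regroup′ t (threshold t) N ⟩
    suc t * (2 * threshold t + N)     ∎)
    where
    open ≤-Reasoning
    S : List (Code n k)
    S = filter P? (allCodes n k)
    s : ℕ
    s = length S
    t : ℕ
    t = length Q
    ℓ : ℕ
    ℓ = suc (t + t)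
    D : ℕ
    D = 2 ^ (t * q₀)
    N : ℕ
    N = k ^ n
    regroup : ∀ t s → suc t * (2 * s) ≡ suc (suc (t + t)) * s
    regroup = solve-∀
    regroup′ : ∀ t x N → suc (suc (t + t)) * x + suc t * N ≡ suc t * (2 * x + N)
    regroup′ = solve-∀
    summed : D * (suc ℓ * s) ≤ D * (suc ℓ * threshold t + t * N)
    summed = begin
      D * (suc ℓ * s)
        ≡⟨ trans (shuffle D (suc ℓ) s) (sym (sum-map-const (D * suc ℓ) S)) ⟩
      sum (map (λ _ → D * suc ℓ) S)
        ≤⟨ sum-map-mono _ _ S (λ {z} _ → markov ℓ Q z) ⟩
      sum (map (λ z → suc ℓ * 2 ^ ℓ * mass Q z + D * level Q z) S)
        ≡⟨ sum-map-+ _ _ S ⟩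
      sum (map (λ z → suc ℓ * 2 ^ ℓ * mass Q z) S) + sum (map (λ z → D * level Q z) S)
        ≡⟨ cong₂ _+_ (sum-map-*ˡ (suc ℓ * 2 ^ ℓ) (mass Q) S) (sum-map-*ˡ D (level Q) S) ⟩
      suc ℓ * 2 ^ ℓ * sum (map (mass Q) S) + D * sum (map (level Q) S)
        ≤⟨ +-mono-≤ (*-monoʳ-≤ (suc ℓ * 2 ^ ℓ) (mass-sum-bound Q S (Unique.filter⁺ P? (allCodes-unique n k)) sep))
                    (*-monoʳ-≤ D level-bound) ⟩
      suc ℓ * 2 ^ ℓ * (B ^ t * 2 ^ t * D) + D * (t * N)
        ≡⟨ shuffle′ (suc ℓ) (2 ^ ℓ) (B ^ t * 2 ^ t) D (t * N) ⟩
      D * (suc ℓ * (2 ^ ℓ * (B ^ t * 2 ^ t)) + t * N)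
        ≡⟨ cong (λ x → D * (suc ℓ * x + t * N)) (threshold-unfold t) ⟩
      D * (suc ℓ * threshold t + t * N) ∎
      where
      level-bound : sum (map (level Q) S) ≤ t * N
      level-bound = ≤-trans (sum-map-filter≤ P? (level Q) (allCodes n k)) (level-sum-bound n≤B*k Q)
      shuffle : ∀ d a s → d * (a * s) ≡ s * (d * a)
      shuffle = solve-∀
      shuffle′ : ∀ a p y d r → a * p * (y * d) + d * r ≡ d * (a * (p * y) + r)
      shuffle′ = solve-∀

module _ {n k} (σ : Strategy n k) where

  firstQueries : ℕ → List (Code n k)
  firstQueries zero    = []
  firstQueries (suc j) with j <? k ^ n
  ... | yes j<N = query σ (fromℕ< j<N) ∷ firstQueries j
  ... | no  _   = firstQueries j

  length-firstQueries : ∀ J → length (firstQueries J) ≤ J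
  length-firstQueries zero    = z≤n
  length-firstQueries (suc j) with j <? k ^ n
  ... | yes _ = s≤s (length-firstQueries j)
  ... | no  _ = m≤n⇒m≤1+n (length-firstQueries j)

  ∈-firstQueries : ∀ J (i : Fin (k ^ n)) → toℕ i < J → query σ i ∈ firstQueries J
  ∈-firstQueries (suc j) i i<1+j with j <? k ^ n | m≤n⇒m<n∨m≡n (s≤s⁻¹ i<1+j)
  ... | yes j<N | inj₂ refl = here (cong (query σ) (sym (Fin.fromℕ<-toℕ i j<N)))
  ... | yes _   | inj₁ i<j  = there (∈-firstQueries j i i<j)
  ... | no  j≮N | inj₂ refl = ⊥-elim (j≮N (Fin.toℕ<n i))
  ... | no  _   | inj₁ i<j  = ∈-firstQueries j i i<j

  ¬Determined-0 : 2 ≤ k → 0 < n → ∀ z → ¬ Determined σ z 0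
  ¬Determined-0 (s≤s (s≤s _)) _ (a ∷ z) det = other≢ a (Vec.∷-injectiveˡ (det (other a ∷ z) (λ _ ())))
    where
    other : ∀ {k₂} → Fin (suc (suc k₂)) → Fin (suc (suc k₂))
    other fzero    = fsuc fzero
    other (fsuc _) = fzero
    other≢ : ∀ {k₂} (a : Fin (suc (suc k₂))) → other a ≢ a
    other≢ fzero    ()
    other≢ (fsuc _) ()

-- PowerBound k M a Z says Z ≤ (M/k)^a, without division.
record PowerBound (k M a Z : ℕ) : Set where
  constructor powerBound
  field bound : k ^ a * Z ≤ M ^ a

PowerBound-* : ∀ {k M a b X Y} → PowerBound k M a X → PowerBound k M b Y → PowerBound k M (a + b) (X * Y)
PowerBound-* {k} {M} {a} {b} {X} {Y} (powerBound hX) (powerBound hY) = powerBound (begin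
  k ^ (a + b) * (X * Y)        ≡⟨ cong (_* (X * Y)) (^-distribˡ-+-* k a b) ⟩
  k ^ a * k ^ b * (X * Y)      ≡⟨ shuffle (k ^ a) (k ^ b) X Y ⟩
  (k ^ a * X) * (k ^ b * Y)    ≤⟨ *-mono-≤ hX hY ⟩
  M ^ a * M ^ b                ≡⟨ sym (^-distribˡ-+-* M a b) ⟩
  M ^ (a + b)                  ∎)
  where
  open ≤-Reasoning
  shuffle : ∀ p q x y → p * q * (x * y) ≡ (p * x) * (q * y)
  shuffle = solve-∀

PowerBound-^ : ∀ {k M a Z} → PowerBound k M a Z → ∀ w → PowerBound k M (a * w) (Z ^ w)
PowerBound-^ {k} {M} {a} {Z} (powerBound h) w = powerBound (begin
  k ^ (a * w) * Z ^ w     ≡⟨ cong (_* Z ^ w) (sym (^-*-assoc k a w)) ⟩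
  (k ^ a) ^ w * Z ^ w     ≡⟨ sym (^-distribʳ-* (k ^ a) Z w) ⟩
  (k ^ a * Z) ^ w         ≤⟨ ^-monoˡ-≤ w h ⟩
  (M ^ a) ^ w             ≡⟨ ^-*-assoc M a w ⟩
  M ^ (a * w)             ∎)
  where open ≤-Reasoning

PowerBound-mono-exponent : ∀ {k M a b Z} → k ≤ M → a ≤ b → PowerBound k M a Z → PowerBound k M b Z
PowerBound-mono-exponent {k} {M} {a} {b} {Z} k≤M a≤b h =
  subst₂ (PowerBound k M) (m+[n∸m]≡n a≤b) (*-identityʳ Z) (PowerBound-* h k^d≤M^d)
  where
  k^d≤M^d : PowerBound k M (b ∸ a) 1
  k^d≤M^d = powerBound (≤-trans (≤-reflexive (*-identityʳ _)) (^-monoˡ-≤ (b ∸ a) k≤M))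

PowerBound-antimono-value : ∀ {k M a Y Z} → Y ≤ Z → PowerBound k M a Z → PowerBound k M a Y
PowerBound-antimono-value {k} {a = a} Y≤Z (powerBound h) = powerBound (≤-trans (*-monoʳ-≤ (k ^ a) Y≤Z) h)

module _ {n k} {{_ : NonZero k}} (s : CountedStrategy n k) where
  open CountedStrategy s

  private
    N : ℕ
    N = k ^ n
    T : ℕ
    T = totalQueries s
    B : ℕ
    B = suc (n / k)
    M : ℕ
    M = n ⊔ (2 * k)

    2k≤M : 2 * k ≤ M
    2k≤M = m≤n⊔m n (2 * k)

    k≤M : k ≤ M
    k≤M = ≤-trans (m≤m+n k (k + 0)) 2k≤M

  open Kraft n k B

  n≤B*k : n ≤ B * k
  n≤B*k = begin
    n                   ≡⟨ m≡m%n+[m/n]*n n k ⟩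
    n % k + n / k * k   ≤⟨ +-monoˡ-≤ (n / k * k) (<⇒≤ (m%n<n n k)) ⟩
    k + n / k * k       ∎
    where open ≤-Reasoning

  B*k≤k+n : B * k ≤ k + n
  B*k≤k+n = +-monoʳ-≤ k (m/n*n≤m n k)

  fast-codes-separated : ∀ J →
    Separates (firstQueries order J) (filter (λ z → needed z ≤? J) (allCodes n k))
  fast-codes-separated J {y} {z} _ z∈ agree =
    proj₁ (isNeeded z) y (λ i i<needed → All.lookup agree (∈-firstQueries order J i (≤-trans i<needed needed≤J)))
    where
    needed≤J : needed z ≤ J
    needed≤J = proj₂ (∈-filter⁻ (λ z → needed z ≤? J) {xs = allCodes n k} z∈)

  [1+J]*N≤4*T : ∀ J → 4 * threshold J ≤ N → suc J * N ≤ 4 * T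
  [1+J]*N≤4*T J 4X≤N = begin
    suc J * N              ≤⟨ *-monoʳ-≤ (suc J) N≤4*slow ⟩
    suc J * (4 * slow)     ≡⟨ *-comm-middle (suc J) slow ⟩
    4 * (suc J * slow)     ≤⟨ *-monoʳ-≤ 4 slow-cost ⟩
    4 * T                  ∎
    where
    open ≤-Reasoning
    all : List (Code n k)
    all = allCodes n k
    fast? : ∀ z → Dec (needed z ≤ J)
    fast? z = needed z ≤? J
    Q : List (Code n k)
    Q = firstQueries order J
    slow : ℕ
    slow = length (filter (∁? fast?) all)
    *-comm-middle : ∀ a b → a * (4 * b) ≡ 4 * (a * b)
    *-comm-middle = solve-∀
    few-fast : 2 * length (filter fast? all) ≤ 2 * threshold J + N
    few-fast = ≤-trans (few-separated fast? Q n≤B*k (fast-codes-separated J))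
      (+-monoˡ-≤ N (*-monoʳ-≤ 2 (*-monoʳ-≤ 2 (^-monoʳ-≤ (8 * B) (length-firstQueries order J)))))
    N≤4*slow : N ≤ 4 * slow
    N≤4*slow = N≤4*complement {a = length (filter fast? all)} {b = slow} {Y = threshold J}
      (trans (sym (length-allCodes n k)) (sym (length-filter-∁ fast? all))) few-fast 4X≤N
    slow-cost : suc J * slow ≤ T
    slow-cost = begin
      suc J * slow                                   ≡⟨ *-comm (suc J) slow ⟩
      slow * suc J                                   ≡⟨ sym (sum-map-const (suc J) (filter (∁? fast?) all)) ⟩
      sum (map (λ _ → suc J) (filter (∁? fast?) all))
        ≤⟨ sum-map-mono _ needed (filter (∁? fast?) all)
             (λ z∈ → ≰⇒> (proj₂ (∈-filter⁻ (∁? fast?) {xs = all} z∈))) ⟩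
      sum (map needed (filter (∁? fast?) all))       ≤⟨ sum-map-filter≤ (∁? fast?) needed all ⟩
      T                                              ∎

  Certificate : Set
  Certificate = Σ ℕ λ a → PowerBound k M a N × a * N ≤ 32 * T

  64B≤[M/k]^8 : PowerBound k M 8 (64 * B)
  64B≤[M/k]^8 = powerBound (begin
    k ^ 8 * (64 * B)          ≡⟨ shuffle k (k ^ 7) B ⟩
    64 * (B * k) * k ^ 7      ≤⟨ *-monoˡ-≤ (k ^ 7) (*-monoʳ-≤ 64 B*k≤M+M) ⟩
    64 * (M + M) * k ^ 7      ≡⟨ shuffle′ M (k ^ 7) ⟩
    2 ^ 7 * k ^ 7 * M         ≡⟨ cong (_* M) (sym (^-distribʳ-* 2 k 7)) ⟩
    (2 * k) ^ 7 * M           ≤⟨ *-monoˡ-≤ M (^-monoˡ-≤ 7 2k≤M) ⟩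
    M ^ 7 * M                 ≡⟨ *-comm (M ^ 7) M ⟩
    M ^ 8                     ∎)
    where
    open ≤-Reasoning
    B*k≤M+M : B * k ≤ M + M
    B*k≤M+M = ≤-trans B*k≤k+n (+-mono-≤ k≤M (m≤m⊔n n (2 * k)))
    shuffle : ∀ k p B → k * p * (64 * B) ≡ 64 * (B * k) * p
    shuffle = solve-∀
    shuffle′ : ∀ M p → 64 * (M + M) * p ≡ 128 * p * M
    shuffle′ = solve-∀

  large-certificate : 8 ≤ N → Certificate
  large-certificate 8≤N with crossing (λ j → 4 * threshold j ≤? N) 8≤N N (<⇒≱ (t<4*threshold N))
  ... | J , 4X≤N , 4X≰N =
    8 * suc J
    , PowerBound-antimono-value (≤-trans (<⇒≤ (≰⇒> 4X≰N)) (4*threshold≤[64B]^ J)) (PowerBound-^ 64B≤[M/k]^8 (suc J))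
    , (begin
        8 * suc J * N        ≡⟨ *-assoc 8 (suc J) N ⟩
        8 * (suc J * N)      ≤⟨ *-monoʳ-≤ 8 ([1+J]*N≤4*T J 4X≤N) ⟩
        8 * (4 * T)          ≡⟨ sym (*-assoc 8 4 T) ⟩
        32 * T               ∎)
    where open ≤-Reasoning

  small-certificate : 2 ≤ k → 0 < n → N < 8 → Certificate
  small-certificate 2≤k 0<n N<8 =
    3 , k^3*N≤M^3 , ≤-trans (*-monoˡ-≤ N {3} {32} (s≤s (s≤s (s≤s z≤n)))) (*-monoʳ-≤ 32 N≤T)
    where
    open ≤-Reasoning
    k^3*N≤M^3 : PowerBound k M 3 N
    k^3*N≤M^3 = powerBound (begin
      k ^ 3 * N         ≤⟨ *-monoʳ-≤ (k ^ 3) (<⇒≤ N<8) ⟩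
      k ^ 3 * 8         ≡⟨ *-comm (k ^ 3) 8 ⟩
      2 ^ 3 * k ^ 3     ≡⟨ sym (^-distribʳ-* 2 k 3) ⟩
      (2 * k) ^ 3       ≤⟨ ^-monoˡ-≤ 3 2k≤M ⟩
      M ^ 3             ∎)
    N≤T : N ≤ T
    N≤T = begin
      N                                 ≡⟨ sym (trans (sum-map-allCodes-const n k 1) (*-identityʳ N)) ⟩
      sum (map (λ _ → 1) (allCodes n k)) ≤⟨ sum-map-mono _ needed (allCodes n k) (λ {z} _ → needed>0 z) ⟩
      T                                 ∎
      where
      needed>0 : ∀ z → 0 < needed z
      needed>0 z = n≢0⇒n>0 λ needed≡0 →
        ¬Determined-0 order 2≤k 0<n z (subst (Determined order z) needed≡0 (proj₁ (isNeeded z)))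

  certificate : 2 ≤ k → Certificate
  certificate 2≤k with n ≟ 0 | 8 ≤? N
  ... | yes n≡0 | _       = 0 , powerBound (subst (λ m → 1 * k ^ m ≤ 1) (sym n≡0) ≤-refl) , z≤n
  ... | no  _   | yes 8≤N = large-certificate 8≤N
  ... | no  n≢0 | no  8≰N = small-certificate 2≤k (n≢0⇒n>0 n≢0) (≰⇒> 8≰N)

  strategy-bound : 2 ≤ k → PowerBound k M (32 * T) (N ^ N)
  strategy-bound 2≤k with certificate 2≤k
  ... | a , bound , aN≤32T = PowerBound-mono-exponent k≤M aN≤32T (PowerBound-^ bound N)

randomized-bound : ∀ {n k} → 2 ≤ k → (R : Randomized n k) →
  PowerBound k (n ⊔ (2 * k)) (32 * weightedTotal R) (k ^ (n * (totalWeight R * k ^ n)))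
randomized-bound {n} _ [] rewrite *-zeroʳ n = powerBound ≤-refl
randomized-bound {n} {k} 2≤k@(s≤s (s≤s _)) ((w , s) ∷ R) =
  subst₂ (PowerBound k (n ⊔ (2 * k))) (regroup T (weightedTotal R) w) value
    (PowerBound-* (PowerBound-^ (strategy-bound s 2≤k) w)
                  (randomized-bound 2≤k R))
  where
  open ≡-Reasoning
  T : ℕ
  T = totalQueries s
  N : ℕ
  N = k ^ n
  W : ℕ
  W = totalWeight R
  regroup : ∀ T A w → 32 * T * w + 32 * A ≡ 32 * (w * T + A)
  regroup = solve-∀
  value : (N ^ N) ^ w * k ^ (n * (W * N)) ≡ k ^ (n * ((w + W) * N))
  value = begin
    (N ^ N) ^ w * k ^ (n * (W * N))       ≡⟨ cong (λ x → x ^ w * k ^ (n * (W * N))) (^-*-assoc k n N) ⟩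
    (k ^ (n * N)) ^ w * k ^ (n * (W * N)) ≡⟨ cong (_* k ^ (n * (W * N))) (^-*-assoc k (n * N) w) ⟩
    k ^ (n * N * w) * k ^ (n * (W * N))   ≡⟨ sym (^-distribˡ-+-* k (n * N * w) _) ⟩
    k ^ (n * N * w + n * (W * N))         ≡⟨ cong (k ^_) (distribute n N w W) ⟩
    k ^ (n * ((w + W) * N))               ∎
    where
    distribute : ∀ n N w W → n * N * w + n * (W * N) ≡ n * ((w + W) * N)
    distribute = solve-∀

-- The expected number of queries is weightedTotal R / (totalWeight R · k^n), so the bound says it is
-- at least n log k / (C log(max(n,2k)/k)), and log(max(n,2k)/k) ≍ max(log(n/k), 1).
theorem11 : Σ ℕ λ C → (0 < C) ×
              (∀ (n k : ℕ) → 2 ≤ k → (R : Randomized n k) → 0 < totalWeight R →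
                k ^ (C * weightedTotal R) * k ^ (n * (totalWeight R * k ^ n))
                  ≤ (n ⊔ (2 * k)) ^ (C * weightedTotal R))
theorem11 = 32 , s≤s z≤n , λ n k 2≤k R _ → PowerBound.bound (randomized-bound 2≤k R)
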